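{- Let $k\geq 3$, $\ell\geq 0$, $p\geq 2$ be integers and $m=|V(C_{k,\ell}^{p+1})|$. (i) If $Y$ is any graph in $\mathcal{Y}_{k+1,\ell+1}$, then $C_{k,\ell}^{p+1}\subseteq Y\vee K_{p-1}(m,m,\dots,m)$. (ii) $C_{k,\ell}^{p+1}\subseteq (P_{k+1}\cup P_{\ell+1})\vee K_{p-1}(m,m,\dots,m)$.
   Context: All graphs are finite and simple; $\subseteq$ means "contains as a subgraph (up to isomorphism)". For a graph $H$ and integer $p\geq 2$, the edge blow-up $H^{p+1}$ is obtained from $H$ by replacing each edge by a clique of order $p+1$, where the new vertices of the different cliques are all distinct. The lollipop $C_{k,\ell}$ is obtained from a cycle $C_k$ by identifying one endpoint of a path $P_{\ell+1}$ (on $\ell+1$ vertices) with a vertex of the cycle. $P_n$ is the path on $n$ vertices. $\mathcal{Y}_{k+1,\ell+1}$ is the family of graphs obtained from a path $P_{k+1}$ by identifying an endpoint of a path $P_{\ell+1}$ with one vertex of $P_{k+1}$ that is not an endpoint of $P_{k+1}$ (the other vertices being new). $K_{p-1}(m,\dots,m)$ is the complete $(p-1)$-partite graph with all parts of size $m$ (for $p=2$ this is an independent set of $m$ vertices); $\vee$ is the join and $\cup$ the vertex-disjoint union. -}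

module Defs where

open import Data.Nat using (ℕ; zero; suc; _+_; _*_; _∸_; _≤_; _<_; _<ᵇ_; _≡ᵇ_)
open import Data.Fin using (Fin; toℕ; splitAt; remQuot; quotient)
open import Data.Product using (Σ; _×_; _,_; proj₁; proj₂; ∃)
open import Data.Sum using (_⊎_; inj₁; inj₂)
open import Data.Unit using (⊤)
open import Data.Empty using (⊥)
open import Data.Bool using (if_then_else_)
open import Relation.Binary.PropositionalEquality using (_≡_; _≢_)

-- A finite graph on the vertex set Fin n, given by an adjacency relation.
-- (All graphs constructed below are symmetric and loopless.)
record Graph : Set₁ where
  field
    n   : ℕ
    Adj : Fin n → Fin n → Set
open Graph public

_⊆_ : Graph → Graph → Set
H ⊆ G = Σ (Fin (n H) → Fin (n G)) λ f →
          ((x y : Fin (n H)) → f x ≡ f y → x ≡ y) ×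
          ((x y : Fin (n H)) → Adj H x y → Adj G (f x) (f y))

symAdj : {N : ℕ} → (ℕ → ℕ → Set) → Fin N → Fin N → Set
symAdj E u v = E (toℕ u) (toℕ v) ⊎ E (toℕ v) (toℕ u)

P : ℕ → Graph
P N = record { n = N ; Adj = symAdj (λ a b → suc a ≡ b) }

-- Graph in 𝒴_{k+1,ℓ+1} obtained by attaching at vertex i of P_{k+1}
-- (vertices 0..k) the path i, k+1, k+2, …, k+ℓ  (new vertices k+1..k+ℓ).
-- i is required to be a non-endpoint: 1 ≤ i ≤ k-1 (imposed in the statement).
YE : ℕ → ℕ → ℕ → ℕ → Set
YE k i a b = (suc a ≡ b × b ≤ k) ⊎ ((a ≡ i × b ≡ suc k) ⊎ (suc k ≤ a × suc a ≡ b))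

Y : (k ℓ i : ℕ) → Graph
Y k ℓ i = record { n = suc k + ℓ ; Adj = symAdj (YE k i) }

_∪G_ : Graph → Graph → Graph
G ∪G H = record { n = n G + n H ; Adj = A }
  where
  A : Fin (n G + n H) → Fin (n G + n H) → Set
  A x y with splitAt (n G) x | splitAt (n G) y
  ... | inj₁ u | inj₁ v = Adj G u v
  ... | inj₂ u | inj₂ v = Adj H u v
  ... | _      | _      = ⊥

_∨G_ : Graph → Graph → Graph
G ∨G H = record { n = n G + n H ; Adj = A }
  where
  A : Fin (n G + n H) → Fin (n G + n H) → Set
  A x y with splitAt (n G) x | splitAt (n G) y
  ... | inj₁ u | inj₁ v = Adj G u v
  ... | inj₂ u | inj₂ v = Adj H u v
  ... | _      | _      = ⊤

Kmulti : (r m : ℕ) → Graph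
Kmulti r m = record { n = r * m ; Adj = λ x y → quotient {r} m x ≢ quotient {r} m y }

-- A graph given with an indexed edge list: n vertices, e edges,
-- edge number j (j < e) has endpoints ends j (a pair of vertex labels < n).
record EGraph : Set where
  field
    nv   : ℕ
    ne   : ℕ
    ends : ℕ → ℕ × ℕ
open EGraph public

-- Edge blow-up H^{p+1}: each edge j gets p-1 new vertices; the new vertex
-- set is Fin (nv + ne * (p-1)), new vertex (j , t) ↦ remQuot.
module _ (p : ℕ) (H : EGraph) where
  BV : ℕ
  BV = nv H + ne H * (p ∸ 1)

  InClique : Fin BV → Fin (ne H) → Set
  InClique x j with splitAt (nv H) x
  ... | inj₁ u = toℕ u ≡ proj₁ (ends H (toℕ j)) ⊎ toℕ u ≡ proj₂ (ends H (toℕ j))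
  ... | inj₂ w = proj₁ (remQuot {ne H} (p ∸ 1) w) ≡ j

  blowup : Graph
  blowup = record { n = BV ; Adj = λ x y → x ≢ y × ∃ λ j → InClique x j × InClique y j }

-- Lollipop C_{k,ℓ}: cycle 0,1,…,k-1 and path 0, k, k+1, …, k+ℓ-1.
-- Edges: j < k-1 : {j, j+1};  j = k-1 : {k-1, 0};  j = k : {0, k};
-- k < j < k+ℓ : {j-1, j}.
lolEnds : ℕ → ℕ → ℕ × ℕ
lolEnds k j =
  if suc j <ᵇ k then (j , suc j)
  else if suc j ≡ᵇ k then (j , 0)
  else if j ≡ᵇ k then (0 , k)
  else (j ∸ 1 , j)

lollipop : ℕ → ℕ → EGraph
lollipop k ℓ = record { nv = k + ℓ ; ne = k + ℓ ; ends = lolEnds k }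

-- Choose a centre c of the lollipop.  Embed the blow-up into G ∨ K_{p−1}(m, …, m), G the host
-- graph, by sending c to the first part of K and the t-th new vertex of every edge to the t-th
-- part, except that the first new vertex of each edge j at c is sent to a vertex ψ j of G.  Two
-- vertices of a common clique then lie in different parts, or one in K and one in G, or both in
-- G, and in the last case they are adjacent provided φ embeds the lollipop minus c into G and
-- each ψ j is a fresh vertex adjacent to the image of the other endpoint of j.  For (i), c is the
-- cycle vertex at distance i from the stem: what remains is a path with the stem hanging at its
-- i-th vertex, which fits into Y leaving both ends of its long path free for the two ψ's.  For
-- (ii), c is the stem vertex: what remains are paths on k−1 and ℓ vertices, placed in P_{k+1}
-- and P_{ℓ+1} so that both ends of the first and one end of the second stay free for the three
-- ψ's.  A vertex sent to K keeps its own index inside its part, so parts of size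
-- m = |V(C_{k,ℓ}^{p+1})| suffice.
module Submission where

open import Defs
open import Data.Bool using (true; false; T)
open import Data.Bool.Properties using (T-≡)
open import Data.Empty using (⊥-elim)
open import Data.Fin as Fin using (Fin; toℕ; fromℕ<; splitAt; combine; _↑ˡ_; _↑ʳ_)
open import Data.Fin.Properties
  using (toℕ-injective; toℕ<n; toℕ-fromℕ<; toℕ-↑ˡ; toℕ-↑ʳ; ↑ˡ-injective; ↑ʳ-injective;
         splitAt-↑ˡ; splitAt-↑ʳ; splitAt⁻¹-↑ˡ; splitAt⁻¹-↑ʳ; remQuot-combine; combine-remQuot;
         combine-injective)
open import Data.Nat
open import Data.Nat.Properties
open import Data.Product using (Σ; _×_; _,_; proj₁; proj₂)
open import Data.Sum using (_⊎_; inj₁; inj₂; [_,_]′; swap)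
open import Data.Unit using (⊤; tt)
open import Function using (_∘_)
open import Function.Bundles using (Equivalence)
open import Relation.Binary.Definitions using (tri<; tri≈; tri>)
open import Relation.Binary.PropositionalEquality
open import Relation.Nullary using (¬_; yes; no)
open import Relation.Nullary.Decidable using (_⊎-dec_)
open import Relation.Unary using (Decidable)

↑ˡ≢↑ʳ : ∀ {m n} (i : Fin m) (j : Fin n) → i ↑ˡ n ≢ m ↑ʳ j
↑ˡ≢↑ʳ {m} {n} i j e
  with () ← trans (sym (splitAt-↑ˡ m i n)) (trans (cong (splitAt m) e) (splitAt-↑ʳ m n j))

toℕ-splitAt-inj₁ : ∀ m {n} {g : Fin (m + n)} {a} → splitAt m g ≡ inj₁ a → toℕ g ≡ toℕ a
toℕ-splitAt-inj₁ m {n} {a = a} eq = trans (cong toℕ (sym (splitAt⁻¹-↑ˡ eq))) (toℕ-↑ˡ a n)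

toℕ-splitAt-inj₂ : ∀ m {n} {g : Fin (m + n)} {b} → splitAt m g ≡ inj₂ b → toℕ g ≡ m + toℕ b
toℕ-splitAt-inj₂ m {b = b} eq = trans (cong toℕ (sym (splitAt⁻¹-↑ʳ eq))) (toℕ-↑ʳ m b)

module _ (G H : Graph) where

  ∨G-adj-↑ˡ : ∀ {a b} → Adj G a b → Adj (G ∨G H) (a ↑ˡ n H) (b ↑ˡ n H)
  ∨G-adj-↑ˡ {a} {b} adj rewrite splitAt-↑ˡ (n G) a (n H) | splitAt-↑ˡ (n G) b (n H) = adj

  ∨G-adj-↑ʳ : ∀ {a b} → Adj H a b → Adj (G ∨G H) (n G ↑ʳ a) (n G ↑ʳ b)
  ∨G-adj-↑ʳ {a} {b} adj rewrite splitAt-↑ʳ (n G) (n H) a | splitAt-↑ʳ (n G) (n H) b = adj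

  ∨G-adj-↑ˡ↑ʳ : ∀ a b → Adj (G ∨G H) (a ↑ˡ n H) (n G ↑ʳ b)
  ∨G-adj-↑ˡ↑ʳ a b rewrite splitAt-↑ˡ (n G) a (n H) | splitAt-↑ʳ (n G) (n H) b = tt

  ∨G-adj-↑ʳ↑ˡ : ∀ a b → Adj (G ∨G H) (n G ↑ʳ b) (a ↑ˡ n H)
  ∨G-adj-↑ʳ↑ˡ a b rewrite splitAt-↑ˡ (n G) a (n H) | splitAt-↑ʳ (n G) (n H) b = tt

Kmulti-adj : ∀ {r m s t} (x y : Fin m) → s ≢ t → Adj (Kmulti r m) (combine s x) (combine t y)
Kmulti-adj {r} {m} {s} {t} x y s≢t e =
  s≢t (trans (cong proj₁ (sym (remQuot-combine {r} {m} s x))) (trans e (cong proj₁ (remQuot-combine t y))))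

P∪P-adj : ∀ m n {g g′ : Fin (m + n)} → suc (toℕ g) ≡ toℕ g′ → toℕ g′ ≢ m →
          Adj (P m ∪G P n) g g′ × Adj (P m ∪G P n) g′ g
P∪P-adj m n {g} {g′} step g′≢m with splitAt m g in eq | splitAt m g′ in eq′
... | inj₁ a | inj₁ b = inj₁ step′ , inj₂ step′
  where
  step′ : suc (toℕ a) ≡ toℕ b
  step′ = trans (cong suc (sym (toℕ-splitAt-inj₁ m eq))) (trans step (toℕ-splitAt-inj₁ m eq′))
... | inj₂ a | inj₂ b = inj₁ step′ , inj₂ step′
  where
  step′ : suc (toℕ a) ≡ toℕ b
  step′ = +-cancelˡ-≡ m _ _ (trans (+-suc m (toℕ a))
            (trans (cong suc (sym (toℕ-splitAt-inj₂ m eq))) (trans step (toℕ-splitAt-inj₂ m eq′))))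
... | inj₁ a | inj₂ b = ⊥-elim (g′≢m (≤-antisym g′≤m m≤g′))
  where
  g′≤m : toℕ g′ ≤ m
  g′≤m = subst (_≤ m) (trans (cong suc (sym (toℕ-splitAt-inj₁ m eq))) step) (toℕ<n a)
  m≤g′ : m ≤ toℕ g′
  m≤g′ = subst (m ≤_) (sym (toℕ-splitAt-inj₂ m eq′)) (m≤m+n m (toℕ b))
... | inj₂ a | inj₁ b = ⊥-elim (<-asym g′<m m<g′)
  where
  g′<m : toℕ g′ < m
  g′<m = subst (_< m) (sym (toℕ-splitAt-inj₁ m eq′)) (toℕ<n b)
  m<g′ : m < toℕ g′
  m<g′ = subst (m <_) step (s≤s (subst (m ≤_) (sym (toℕ-splitAt-inj₂ m eq)) (m≤m+n m (toℕ a))))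

-- A place in G ∨ K_r(m) is a vertex of G or one of the r parts of K.
PlacedAdj : (G : Graph) {r : ℕ} → Fin (n G) ⊎ Fin r → Fin (n G) ⊎ Fin r → Set
PlacedAdj G (inj₁ g) (inj₁ g′) = Adj G g g′
PlacedAdj G (inj₂ s) (inj₂ t)  = s ≢ t
PlacedAdj G _        _         = ⊤

module _ (B G : Graph) {r : ℕ} (place : Fin (n B) → Fin (n G) ⊎ Fin r) where

  private
    K = Kmulti r (n B)

  placed : Fin (n G) ⊎ Fin r → Fin (n B) → Fin (n G + r * n B)
  placed (inj₁ g) x = g ↑ˡ r * n B
  placed (inj₂ t) x = n G ↑ʳ combine t x

  placed-adj : ∀ a b x y → PlacedAdj G a b → Adj (G ∨G K) (placed a x) (placed b y)
  placed-adj (inj₁ g) (inj₁ g′) x y adj = ∨G-adj-↑ˡ G K adj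
  placed-adj (inj₁ g) (inj₂ t)  x y _   = ∨G-adj-↑ˡ↑ʳ G K g (combine t y)
  placed-adj (inj₂ s) (inj₁ g)  x y _   = ∨G-adj-↑ʳ↑ˡ G K g (combine s x)
  placed-adj (inj₂ s) (inj₂ t)  x y s≢t = ∨G-adj-↑ʳ G K (Kmulti-adj x y s≢t)

  ⊆-∨G-Kmulti : (∀ x y {g} → place x ≡ inj₁ g → place y ≡ inj₁ g → x ≡ y) →
                (∀ x y → Adj B x y → PlacedAdj G (place x) (place y)) →
                B ⊆ (G ∨G K)
  ⊆-∨G-Kmulti place-injective place-adj =
    embed , embed-injective , λ x y adj → placed-adj (place x) (place y) x y (place-adj x y adj)
    where
    embed : Fin (n B) → Fin (n G + r * n B)
    embed x = placed (place x) x

    embed-injective : ∀ x y → embed x ≡ embed y → x ≡ y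
    embed-injective x y e with place x in px | place y in py
    ... | inj₁ g | inj₁ g′ = place-injective x y px (trans py (cong inj₁ (sym (↑ˡ-injective _ g g′ e))))
    ... | inj₁ g | inj₂ t  = ⊥-elim (↑ˡ≢↑ʳ g (combine t y) e)
    ... | inj₂ s | inj₁ g  = ⊥-elim (↑ˡ≢↑ʳ g (combine s x) (sym e))
    ... | inj₂ s | inj₂ t  = proj₂ (combine-injective s x t y (↑ʳ-injective _ _ _ e))

Incident : EGraph → ℕ → ℕ → Set
Incident H u j = u ≡ proj₁ (ends H j) ⊎ u ≡ proj₂ (ends H j)

module BlowupVertex (H : EGraph) (r : ℕ) where

  data View : Fin (BV (suc r) H) → Set where
    old : (u : Fin (nv H)) → View (u ↑ˡ ne H * r)
    new : (j : Fin (ne H)) (t : Fin r) → View (nv H ↑ʳ combine j t)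

  view : ∀ x → View x
  view x with splitAt (nv H) x in eq
  ... | inj₁ u = subst View (splitAt⁻¹-↑ˡ eq) (old u)
  ... | inj₂ w =
    subst View (trans (cong (nv H ↑ʳ_) (combine-remQuot {ne H} r w)) (splitAt⁻¹-↑ʳ eq)) (new _ _)

  inClique-old : ∀ {u j} → InClique (suc r) H (u ↑ˡ ne H * r) j → Incident H (toℕ u) (toℕ j)
  inClique-old {u} rewrite splitAt-↑ˡ (nv H) u (ne H * r) = λ u∈j → u∈j

  inClique-new : ∀ {i t j} → InClique (suc r) H (nv H ↑ʳ combine i t) j → i ≡ j
  inClique-new {i} {t} rewrite splitAt-↑ʳ (nv H) (ne H * r) (combine i t) =
    trans (cong proj₁ (sym (remQuot-combine i t)))

-- Star may be any decidable set of edges containing those at the centre.  Vertices of G are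
-- handled through their labels toℕ, so φ, ψ and the adjacency _~_ live on ℕ.
record StarPlacement (H : EGraph) (G : Graph) : Set₁ where
  field
    centre          : ℕ
    Star            : ℕ → Set
    star?           : Decidable Star
    incident⇒star   : ∀ {j} → Incident H centre j → Star j
    φ               : ℕ → ℕ
    ψ               : ∀ j → Star j → ℕ
    φ<              : ∀ {u} → u < nv H → u ≢ centre → φ u < n G
    ψ<              : ∀ {j} (s : Star j) → ψ j s < n G
    φ-injective     : ∀ {u u′} → u ≢ centre → u′ ≢ centre → φ u ≡ φ u′ → u ≡ u′
    ψ-injective     : ∀ {j j′} (s : Star j) (s′ : Star j′) → ψ j s ≡ ψ j′ s′ → j ≡ j′
    φ≢ψ             : ∀ {u j} (s : Star j) → u ≢ centre → φ u ≢ ψ j s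
    _~_             : ℕ → ℕ → Set
    ~-sym           : ∀ {a b} → a ~ b → b ~ a
    ~⇒adj           : ∀ {g g′ : Fin (n G)} → toℕ g ~ toℕ g′ → Adj G g g′
    edge~           : ∀ j → proj₁ (ends H j) ≢ centre → proj₂ (ends H j) ≢ centre →
                      φ (proj₁ (ends H j)) ~ φ (proj₂ (ends H j))
    star~           : ∀ {u j} (s : Star j) → Incident H u j → u ≢ centre → φ u ~ ψ j s

module _ {H : EGraph} {G : Graph} (P : StarPlacement H G) (r : ℕ) where
  open StarPlacement P
  open BlowupVertex H (suc r)

  placeOld : Fin (nv H) → Fin (n G) ⊎ Fin (suc r)
  placeOld u with toℕ u ≟ centre
  ... | yes _   = inj₂ Fin.zero
  ... | no u≢c = inj₁ (fromℕ< (φ< (toℕ<n u) u≢c))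

  placeNew : Fin (ne H) → Fin (suc r) → Fin (n G) ⊎ Fin (suc r)
  placeNew j Fin.zero with star? (toℕ j)
  ... | yes s = inj₁ (fromℕ< (ψ< s))
  ... | no _  = inj₂ Fin.zero
  placeNew j (Fin.suc t) = inj₂ (Fin.suc t)

  placeOld-inj₁ : ∀ {u g} → placeOld u ≡ inj₁ g → toℕ u ≢ centre × toℕ g ≡ φ (toℕ u)
  placeOld-inj₁ {u} e with toℕ u ≟ centre | e
  ... | no u≢c | refl = u≢c , toℕ-fromℕ< _

  placeOld-inj₂ : ∀ {u t} → placeOld u ≡ inj₂ t → toℕ u ≡ centre × t ≡ Fin.zero
  placeOld-inj₂ {u} e with toℕ u ≟ centre | e
  ... | yes u≡c | refl = u≡c , refl

  placeNew-inj₁ : ∀ j t {g} → placeNew j t ≡ inj₁ g →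
                  t ≡ Fin.zero × Σ (Star (toℕ j)) λ s → toℕ g ≡ ψ (toℕ j) s
  placeNew-inj₁ j Fin.zero e with star? (toℕ j) | e
  ... | yes s | refl = refl , s , toℕ-fromℕ< _

  placeNew-inj₂ : ∀ j t {t′} → placeNew j t ≡ inj₂ t′ → t′ ≡ t × (t ≡ Fin.zero → ¬ Star (toℕ j))
  placeNew-inj₂ j Fin.zero e with star? (toℕ j) | e
  ... | no ¬s | refl = refl , λ _ → ¬s
  placeNew-inj₂ j (Fin.suc t) refl = refl , λ ()

  placeView : ∀ {x} → View x → Fin (n G) ⊎ Fin (suc r)
  placeView (old u)   = placeOld u
  placeView (new j t) = placeNew j t

  placeView-injective : ∀ {x y g} (vx : View x) (vy : View y) →
                        placeView vx ≡ inj₁ g → placeView vy ≡ inj₁ g → x ≡ y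
  placeView-injective (old u) (old u′) e e′ with placeOld-inj₁ e | placeOld-inj₁ e′
  ... | u≢c , gu | u′≢c , gu′ =
    cong (_↑ˡ _) (toℕ-injective (φ-injective u≢c u′≢c (trans (sym gu) gu′)))
  placeView-injective (old u) (new j t) e e′ with placeOld-inj₁ e | placeNew-inj₁ j t e′
  ... | u≢c , gu | _ , s , gj = ⊥-elim (φ≢ψ s u≢c (trans (sym gu) gj))
  placeView-injective (new j t) (old u) e e′ = sym (placeView-injective (old u) (new j t) e′ e)
  placeView-injective (new j t) (new j′ t′) e e′ with placeNew-inj₁ j t e | placeNew-inj₁ j′ t′ e′
  ... | refl , s , gj | refl , s′ , gj′ =
    cong (λ i → nv H ↑ʳ combine i Fin.zero) (toℕ-injective (ψ-injective s s′ (trans (sym gj) gj′)))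

  endpoints~ : ∀ {u u′ j} → u ≢ u′ → Incident H u j → Incident H u′ j →
               u ≢ centre → u′ ≢ centre → φ u ~ φ u′
  endpoints~ u≢u′ (inj₁ refl) (inj₁ refl) _   _    = ⊥-elim (u≢u′ refl)
  endpoints~ _    (inj₁ refl) (inj₂ refl) u≢c u′≢c = edge~ _ u≢c u′≢c
  endpoints~ _    (inj₂ refl) (inj₁ refl) u≢c u′≢c = ~-sym (edge~ _ u′≢c u≢c)
  endpoints~ u≢u′ (inj₂ refl) (inj₂ refl) _   _    = ⊥-elim (u≢u′ refl)

  old-old-adj : ∀ {u u′ j} → u ≢ u′ → Incident H (toℕ u) j → Incident H (toℕ u′) j →
                PlacedAdj G (placeOld u) (placeOld u′)
  old-old-adj {u} {u′} u≢u′ u∈j u′∈j with placeOld u in e | placeOld u′ in e′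
  ... | inj₁ g | inj₁ g′ with placeOld-inj₁ e | placeOld-inj₁ e′
  ...   | u≢c , gu | u′≢c , gu′ =
    ~⇒adj (subst₂ _~_ (sym gu) (sym gu′) (endpoints~ (u≢u′ ∘ toℕ-injective) u∈j u′∈j u≢c u′≢c))
  old-old-adj u≢u′ u∈j u′∈j | inj₁ _ | inj₂ _ = tt
  old-old-adj u≢u′ u∈j u′∈j | inj₂ _ | inj₁ _ = tt
  old-old-adj u≢u′ u∈j u′∈j | inj₂ _ | inj₂ _ =
    ⊥-elim (u≢u′ (toℕ-injective (trans (proj₁ (placeOld-inj₂ e)) (sym (proj₁ (placeOld-inj₂ e′))))))

  old-new-adj : ∀ {u j} t → Incident H (toℕ u) (toℕ j) →
                PlacedAdj G (placeOld u) (placeNew j t) × PlacedAdj G (placeNew j t) (placeOld u)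
  old-new-adj {u} {j} t u∈j with placeOld u in e | placeNew j t in e′
  ... | inj₁ g | inj₁ g′ with placeOld-inj₁ e | placeNew-inj₁ j t e′
  ...   | u≢c , gu | _ , s , gj =
    ~⇒adj (subst₂ _~_ (sym gu) (sym gj) φu~ψj) , ~⇒adj (subst₂ _~_ (sym gj) (sym gu) (~-sym φu~ψj))
    where φu~ψj = star~ s u∈j u≢c
  old-new-adj t u∈j | inj₁ _ | inj₂ _ = tt , tt
  old-new-adj t u∈j | inj₂ _ | inj₁ _ = tt , tt
  old-new-adj {u} {j} t u∈j | inj₂ _ | inj₂ _ with placeOld-inj₂ e | placeNew-inj₂ j t e′
  ...   | u≡c , refl | refl , ¬star = centre∉K ∘ sym , centre∉K
    where
    centre∉K : t ≢ Fin.zero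
    centre∉K t≡0 = ¬star t≡0 (incident⇒star (subst (λ c → Incident H c (toℕ j)) u≡c u∈j))

  new-new-adj : ∀ {j t t′} → t ≢ t′ → PlacedAdj G (placeNew j t) (placeNew j t′)
  new-new-adj {j} {t} {t′} t≢t′ with placeNew j t in e | placeNew j t′ in e′
  ... | inj₁ _ | inj₁ _ =
    ⊥-elim (t≢t′ (trans (proj₁ (placeNew-inj₁ j t e)) (sym (proj₁ (placeNew-inj₁ j t′ e′)))))
  ... | inj₁ _ | inj₂ _ = tt
  ... | inj₂ _ | inj₁ _ = tt
  ... | inj₂ _ | inj₂ _ =
    λ s≡s′ → t≢t′ (trans (sym (proj₁ (placeNew-inj₂ j t e)))
                         (trans s≡s′ (proj₁ (placeNew-inj₂ j t′ e′))))

  placeView-adj : ∀ {x y j} (vx : View x) (vy : View y) → x ≢ y →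
                  InClique (suc (suc r)) H x j → InClique (suc (suc r)) H y j →
                  PlacedAdj G (placeView vx) (placeView vy)
  placeView-adj (old u) (old u′) x≢y u∈j u′∈j =
    old-old-adj (x≢y ∘ cong (_↑ˡ _)) (inClique-old u∈j) (inClique-old u′∈j)
  placeView-adj (old u) (new i t) _ u∈j i∈j with refl ← inClique-new i∈j =
    proj₁ (old-new-adj t (inClique-old u∈j))
  placeView-adj (new i t) (old u) _ i∈j u∈j with refl ← inClique-new i∈j =
    proj₂ (old-new-adj t (inClique-old u∈j))
  placeView-adj (new i t) (new i′ t′) x≢y i∈j i′∈j
    with refl ← inClique-new i∈j | refl ← inClique-new i′∈j =
    new-new-adj (x≢y ∘ cong (λ t → nv H ↑ʳ combine i t))

  blowup-⊆-∨G-Kmulti : blowup (suc (suc r)) H ⊆ (G ∨G Kmulti (suc r) (BV (suc (suc r)) H))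
  blowup-⊆-∨G-Kmulti = ⊆-∨G-Kmulti (blowup (suc (suc r)) H) G (λ x → placeView (view x))
    (λ x y → placeView-injective (view x) (view y))
    (λ x y (x≢y , j , x∈j , y∈j) → placeView-adj (view x) (view y) x≢y x∈j y∈j)

data LollipopEdge (k j : ℕ) : ℕ × ℕ → Set where
  cycle-edge   : suc j < k → LollipopEdge k j (j , suc j)
  closing-edge : suc j ≡ k → LollipopEdge k j (j , 0)
  stem-edge    : j ≡ k → LollipopEdge k j (0 , k)
  tail-edge    : k < j → LollipopEdge k j (j ∸ 1 , j)

lollipopEdge : ∀ k j → LollipopEdge k j (lolEnds k j)
lollipopEdge k j with suc j <ᵇ k in e₁ | suc j ≡ᵇ k in e₂ | j ≡ᵇ k in e₃
... | true  | _     | _     = cycle-edge (<ᵇ⇒< _ _ (Equivalence.from T-≡ e₁))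
... | false | true  | _     = closing-edge (≡ᵇ⇒≡ _ _ (Equivalence.from T-≡ e₂))
... | false | false | true  = stem-edge (≡ᵇ⇒≡ _ _ (Equivalence.from T-≡ e₃))
... | false | false | false = tail-edge k<j
  where
  ¬T : ∀ {b} → b ≡ false → ¬ T b
  ¬T refl ()
  k<j : k < j
  k<j with <-cmp k j
  ... | tri> _ _ j<k with m≤n⇒m<n∨m≡n j<k
  ...   | inj₁ sj<k = ⊥-elim (¬T e₁ (<⇒<ᵇ sj<k))
  ...   | inj₂ sj≡k = ⊥-elim (¬T e₂ (≡⇒≡ᵇ _ _ sj≡k))
  k<j | tri< k<j _ _  = k<j
  k<j | tri≈ _ refl _ = ⊥-elim (¬T e₃ (≡⇒≡ᵇ k k refl))


-- The centre c is the cycle vertex k − i; removing it leaves the path c+1, …, k−1, 0, …, c−1,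
-- which φ lays along 1, …, k−1 so that the stem vertex 0 lands on i; the stem moves up by one.
module AttachedPath (w i ℓ : ℕ) (0<i : 0 < i) where

  c k : ℕ
  c = suc w
  k = c + i

  c<k : c < k
  c<k = m<m+n c 0<i

  φ : ℕ → ℕ
  φ u with u <? c
  ... | yes _ = u + i
  ... | no _ with u <? k
  ...   | yes _ = u ∸ c
  ...   | no _  = suc u

  φ-before : ∀ {u} → u < c → φ u ≡ u + i
  φ-before {u} u<c with u <? c
  ... | yes _   = refl
  ... | no u≮c = ⊥-elim (u≮c u<c)

  φ-after : ∀ {u} → c ≤ u → u < k → φ u ≡ u ∸ c
  φ-after {u} c≤u u<k with u <? c
  ... | yes u<c = ⊥-elim (<⇒≱ u<c c≤u)
  ... | no _ with u <? k
  ...   | yes _   = refl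
  ...   | no u≮k = ⊥-elim (u≮k u<k)

  φ-tail : ∀ {u} → k ≤ u → φ u ≡ suc u
  φ-tail {u} k≤u with u <? c
  ... | yes u<c = ⊥-elim (<⇒≱ (<-trans u<c c<k) k≤u)
  ... | no _ with u <? k
  ...   | yes u<k = ⊥-elim (<⇒≱ u<k k≤u)
  ...   | no _    = refl

  data Piece (u : ℕ) : Set where
    before : u < c → φ u ≡ u + i → i ≤ φ u → φ u < k → Piece u
    after  : c < u → u < k → φ u ≡ u ∸ c → 0 < φ u → φ u < i → Piece u
    tail   : k ≤ u → φ u ≡ suc u → k < φ u → Piece u

  piece : ∀ u → u ≢ c → Piece u
  piece u u≢c with <-cmp u c
  ... | tri< u<c _ _ =
    before u<c φu (subst (i ≤_) (sym φu) (m≤n+m i u)) (subst (_< k) (sym φu) (+-monoˡ-< i u<c))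
    where φu = φ-before u<c
  ... | tri≈ _ u≡c _ = ⊥-elim (u≢c u≡c)
  ... | tri> _ _ c<u with u <? k
  ...   | yes u<k =
    after c<u u<k φu (subst (0 <_) (sym φu) (m<n⇒0<n∸m c<u))
      (subst₂ _<_ (sym φu) (m+n∸m≡n c i) (∸-monoˡ-< u<k (<⇒≤ c<u)))
    where φu = φ-after (<⇒≤ c<u) u<k
  ...   | no u≮k = tail k≤u (φ-tail k≤u) (subst (k <_) (sym (φ-tail k≤u)) (s≤s k≤u))
    where k≤u = ≮⇒≥ u≮k

  φ-injective : ∀ {u u′} → u ≢ c → u′ ≢ c → φ u ≡ φ u′ → u ≡ u′
  φ-injective {u} {u′} u≢c u′≢c e with piece u u≢c | piece u′ u′≢c
  ... | before _ φu _ _     | before _ φu′ _ _     = +-cancelʳ-≡ i u u′ (trans (sym φu) (trans e φu′))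
  ... | before _ _ i≤φu _   | after _ _ _ _ φu′<i   = ⊥-elim (<⇒≱ φu′<i (subst (i ≤_) e i≤φu))
  ... | before _ _ _ φu<k   | tail _ _ k<φu′       = ⊥-elim (<-asym φu<k (subst (k <_) (sym e) k<φu′))
  ... | after _ _ _ _ φu<i  | before _ _ i≤φu′ _   = ⊥-elim (<⇒≱ φu<i (subst (i ≤_) (sym e) i≤φu′))
  ... | after c<u _ φu _ _  | after c<u′ _ φu′ _ _ =
    trans (sym (m+[n∸m]≡n (<⇒≤ c<u)))
          (trans (cong (c +_) (trans (sym φu) (trans e φu′))) (m+[n∸m]≡n (<⇒≤ c<u′)))
  ... | after _ _ _ _ φu<i  | tail _ _ k<φu′       =
    ⊥-elim (<-asym (<-≤-trans φu<i (m≤n+m i c)) (subst (k <_) (sym e) k<φu′))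
  ... | tail _ _ k<φu       | before _ _ _ φu′<k   = ⊥-elim (<-asym φu′<k (subst (k <_) e k<φu))
  ... | tail _ _ k<φu       | after _ _ _ _ φu′<i  =
    ⊥-elim (<-asym (<-≤-trans φu′<i (m≤n+m i c)) (subst (k <_) e k<φu))
  ... | tail _ φu _         | tail _ φu′ _         = suc-injective (trans (sym φu) (trans e φu′))

  φ≢0 : ∀ {u} → u ≢ c → φ u ≢ 0
  φ≢0 {u} u≢c φu≡0 with piece u u≢c
  ... | before _ _ i≤φu _  = <⇒≱ 0<i (subst (i ≤_) φu≡0 i≤φu)
  ... | after _ _ _ 0<φu _ = <⇒≢ 0<φu (sym φu≡0)
  ... | tail _ _ k<φu      = <⇒≱ (subst (k <_) φu≡0 k<φu) z≤n

  φ≢k : ∀ {u} → u ≢ c → φ u ≢ k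
  φ≢k {u} u≢c φu≡k with piece u u≢c
  ... | before _ _ _ φu<k    = <⇒≢ φu<k φu≡k
  ... | after _ _ _ _ φu<i   = <⇒≢ (<-≤-trans φu<i (m≤n+m i c)) φu≡k
  ... | tail _ _ k<φu        = <⇒≢ k<φu (sym φu≡k)

  φ< : ∀ {u} → u < k + ℓ → u ≢ c → φ u < suc k + ℓ
  φ< {u} u<k+ℓ u≢c with piece u u≢c
  ... | before _ _ _ φu<k   = <-≤-trans φu<k (≤-trans (n≤1+n k) (m≤m+n (suc k) ℓ))
  ... | after _ _ _ _ φu<i  = <-≤-trans φu<i (≤-trans (m≤n+m i (suc c)) (m≤m+n (suc k) ℓ))
  ... | tail _ φu _         = subst (_< suc k + ℓ) (sym φu) (s≤s u<k+ℓ)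

  Star : ℕ → Set
  Star j = j ≡ w ⊎ j ≡ c

  ψ : ∀ j → Star j → ℕ
  ψ _ (inj₁ _) = k
  ψ _ (inj₂ _) = 0

  ψ< : ∀ {j} (s : Star j) → ψ j s < suc k + ℓ
  ψ< (inj₁ _) = s≤s (m≤m+n k ℓ)
  ψ< (inj₂ _) = s≤s z≤n

  ψ-injective : ∀ {j j′} (s : Star j) (s′ : Star j′) → ψ j s ≡ ψ j′ s′ → j ≡ j′
  ψ-injective (inj₁ refl) (inj₁ refl) _ = refl
  ψ-injective (inj₂ refl) (inj₂ refl) _ = refl

  φ≢ψ : ∀ {u j} (s : Star j) → u ≢ c → φ u ≢ ψ j s
  φ≢ψ (inj₁ _) = φ≢k
  φ≢ψ (inj₂ _) = φ≢0

  incident⇒star : ∀ {j} → Incident (lollipop k ℓ) c j → Star j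
  incident⇒star {j} c∈j with lolEnds k j | lollipopEdge k j
  ... | _ | cycle-edge _   = [ inj₂ ∘ sym , inj₁ ∘ suc-injective ∘ sym ]′ c∈j
  ... | _ | closing-edge _ = [ inj₂ ∘ sym , (λ ()) ]′ c∈j
  ... | _ | stem-edge _    = [ (λ ()) , (λ c≡k → ⊥-elim (<⇒≢ c<k c≡k)) ]′ c∈j
  ... | _ | tail-edge k<j  = ⊥-elim ([ (λ c≡j∸1 → <⇒≱ c<k (subst (k ≤_) (sym c≡j∸1) (∸-monoˡ-≤ 1 k<j)))
                                     , (λ c≡j → <⇒≱ (<-trans c<k k<j) (≤-reflexive (sym c≡j))) ]′ c∈j)

  _~_ : ℕ → ℕ → Set
  a ~ b = YE k i a b ⊎ YE k i b a

  cycle~ : ∀ {j} → suc j < k → j ≢ c → suc j ≢ c → φ j ~ φ (suc j)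
  cycle~ {j} sj<k j≢c sj≢c with <-cmp j c
  ... | tri< j<c _ _ = subst₂ _~_ (sym (φ-before j<c)) (sym (φ-before sj<c))
                         (inj₁ (inj₁ (refl , +-monoˡ-≤ i (<⇒≤ sj<c))))
    where sj<c = ≤∧≢⇒< j<c sj≢c
  ... | tri≈ _ j≡c _ = ⊥-elim (j≢c j≡c)
  ... | tri> _ _ c<j = subst₂ _~_ (sym (φ-after (<⇒≤ c<j) (<-trans (n<1+n j) sj<k)))
                         (sym (φ-after (≤-trans (<⇒≤ c<j) (n≤1+n j)) sj<k))
                         (inj₁ (inj₁ (sym (+-∸-assoc 1 (<⇒≤ c<j)) , ≤-trans (m∸n≤m (suc j) c) (<⇒≤ sj<k))))

  closing~ : ∀ {j} → suc j ≡ k → j ≢ c → φ j ~ φ 0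
  closing~ {j} sj≡k j≢c = subst₂ _~_ (sym (φ-after c≤j j<k)) (sym (φ-before 0<c))
    (inj₁ (inj₁ (trans (sym (+-∸-assoc 1 c≤j)) (trans (cong (_∸ c) sj≡k) (m+n∸m≡n c i)) , m≤n+m i c)))
    where
    j<k = subst (j <_) sj≡k (n<1+n j)
    c≤j = s≤s⁻¹ (subst (c <_) (sym sj≡k) c<k)
    0<c = s≤s z≤n

  edge~ : ∀ j → proj₁ (lolEnds k j) ≢ c → proj₂ (lolEnds k j) ≢ c →
          φ (proj₁ (lolEnds k j)) ~ φ (proj₂ (lolEnds k j))
  edge~ j with lolEnds k j | lollipopEdge k j
  ... | _ | cycle-edge sj<k  = cycle~ sj<k
  ... | _ | closing-edge sj≡k = λ j≢c _ → closing~ sj≡k j≢c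
  ... | _ | stem-edge _      =
    λ _ _ → subst (φ 0 ~_) (sym (φ-tail ≤-refl)) (inj₁ (inj₂ (inj₁ (refl , refl))))
  ... | _ | tail-edge k<j    = λ _ _ → tail~ k<j
    where
    tail~ : ∀ {j} → k < j → φ (j ∸ 1) ~ φ j
    tail~ {suc j} k<sj = subst₂ _~_ (sym (φ-tail (s≤s⁻¹ k<sj))) (sym (φ-tail (<⇒≤ k<sj)))
                           (inj₁ (inj₂ (inj₂ (s≤s (s≤s⁻¹ k<sj) , refl))))

  star~ : ∀ {u j} (s : Star j) → Incident (lollipop k ℓ) u j → u ≢ c → φ u ~ ψ j s
  star~ {u} (inj₁ refl) u∈j u≢c with lolEnds k w | lollipopEdge k w
  ... | _ | cycle-edge _    = [ (λ { refl → inj₁ (inj₁ (cong suc (φ-before (n<1+n w)) , ≤-refl)) })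
                              , ⊥-elim ∘ u≢c ]′ u∈j
  ... | _ | closing-edge c≡k = ⊥-elim (<⇒≢ c<k c≡k)
  ... | _ | stem-edge w≡k    = ⊥-elim (<⇒≱ (<-trans (n<1+n w) c<k) (≤-reflexive (sym w≡k)))
  ... | _ | tail-edge k<w    = ⊥-elim (<-asym (<-trans (n<1+n w) c<k) k<w)
  star~ {u} (inj₂ refl) u∈j u≢c with lolEnds k c | lollipopEdge k c
  ... | _ | cycle-edge sc<k   =
    [ ⊥-elim ∘ u≢c , (λ { refl → inj₂ (inj₁ (sym φsc≡1 , subst (_≤ k) (sym φsc≡1) (s≤s z≤n))) }) ]′ u∈j
    where φsc≡1 = trans (φ-after (n≤1+n c) sc<k) (m+n∸n≡m 1 c)
  ... | _ | closing-edge sc≡k =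
    [ ⊥-elim ∘ u≢c , (λ { refl → inj₂ (inj₁ (+-cancelˡ-≡ c 1 i (trans (+-comm c 1) sc≡k) , m≤n+m i c)) }) ]′ u∈j
  ... | _ | stem-edge c≡k     = ⊥-elim (<⇒≢ c<k c≡k)
  ... | _ | tail-edge k<c     = ⊥-elim (<-asym c<k k<c)

  placement : StarPlacement (lollipop k ℓ) (Y k ℓ i)
  placement = record
    { centre = c ; Star = Star ; star? = λ j → (j ≟ w) ⊎-dec (j ≟ c)
    ; incident⇒star = incident⇒star ; φ = φ ; ψ = ψ ; φ< = φ< ; ψ< = ψ<
    ; φ-injective = φ-injective ; ψ-injective = ψ-injective ; φ≢ψ = φ≢ψ
    ; _~_ = _~_ ; ~-sym = swap ; ~⇒adj = λ g~g′ → g~g′ ; edge~ = edge~ ; star~ = star~ }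

-- The centre is the stem vertex 0: the rest of the cycle is laid along 1, …, k−1 and the stem
-- along k+2, …, k+ℓ+1, leaving 0, k and k+1 for the three edges at the centre.
module DisjointPaths (k₀ ℓ : ℕ) (0<k₀ : 0 < k₀) where

  k : ℕ
  k = suc k₀

  φ : ℕ → ℕ
  φ u with u <? k
  ... | yes _ = u
  ... | no _  = suc (suc u)

  φ-cycle : ∀ {u} → u < k → φ u ≡ u
  φ-cycle {u} u<k with u <? k
  ... | yes _   = refl
  ... | no u≮k = ⊥-elim (u≮k u<k)

  φ-tail : ∀ {u} → k ≤ u → φ u ≡ suc (suc u)
  φ-tail {u} k≤u with u <? k
  ... | yes u<k = ⊥-elim (<⇒≱ u<k k≤u)
  ... | no _    = refl

  data Piece (u : ℕ) : Set where
    cycle : u < k → φ u ≡ u → Piece u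
    tail  : k ≤ u → φ u ≡ suc (suc u) → Piece u

  piece : ∀ u → Piece u
  piece u with u <? k
  ... | yes u<k = cycle u<k (φ-cycle u<k)
  ... | no u≮k  = tail (≮⇒≥ u≮k) (φ-tail (≮⇒≥ u≮k))

  tail-above : ∀ {u} → k ≤ u → k < suc (suc u)
  tail-above k≤u = ≤-trans (s≤s k≤u) (n≤1+n _)

  φ-injective : ∀ {u u′} → u ≢ 0 → u′ ≢ 0 → φ u ≡ φ u′ → u ≡ u′
  φ-injective {u} {u′} _ _ e with piece u | piece u′
  ... | cycle _ φu   | cycle _ φu′    = trans (sym φu) (trans e φu′)
  ... | cycle u<k φu | tail k≤u′ φu′  =
    ⊥-elim (<-asym u<k (subst (k <_) (trans (sym φu′) (trans (sym e) φu)) (tail-above k≤u′)))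
  ... | tail k≤u φu  | cycle u′<k φu′ =
    ⊥-elim (<-asym u′<k (subst (k <_) (trans (sym φu) (trans e φu′)) (tail-above k≤u)))
  ... | tail _ φu    | tail _ φu′     = suc-injective (suc-injective (trans (sym φu) (trans e φu′)))

  φ< : ∀ {u} → u < k + ℓ → u ≢ 0 → φ u < suc k + suc ℓ
  φ< {u} u<k+ℓ _ with piece u
  ... | cycle u<k φu =
    subst (_< suc k + suc ℓ) (sym φu) (≤-trans u<k (≤-trans (n≤1+n k) (m≤m+n (suc k) (suc ℓ))))
  ... | tail _ φu    =
    subst (_< suc k + suc ℓ) (sym φu) (s≤s (subst (suc u <_) (sym (+-suc k ℓ)) (s≤s u<k+ℓ)))

  Star : ℕ → Set
  Star j = j ≡ 0 ⊎ j ≡ k₀ ⊎ j ≡ k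

  ψ : ∀ j → Star j → ℕ
  ψ _ (inj₁ _)        = 0
  ψ _ (inj₂ (inj₁ _)) = k
  ψ _ (inj₂ (inj₂ _)) = suc k

  ψ< : ∀ {j} (s : Star j) → ψ j s < suc k + suc ℓ
  ψ< (inj₁ _)        = s≤s z≤n
  ψ< (inj₂ (inj₁ _)) = s≤s (m≤m+n k (suc ℓ))
  ψ< (inj₂ (inj₂ _)) = s≤s (m<m+n k (s≤s z≤n))

  pred-ψ : ∀ {j} (s : Star j) → pred (ψ j s) ≡ j
  pred-ψ (inj₁ refl)        = refl
  pred-ψ (inj₂ (inj₁ refl)) = refl
  pred-ψ (inj₂ (inj₂ refl)) = refl

  ψ-injective : ∀ {j j′} (s : Star j) (s′ : Star j′) → ψ j s ≡ ψ j′ s′ → j ≡ j′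
  ψ-injective s s′ e = trans (sym (pred-ψ s)) (trans (cong pred e) (pred-ψ s′))

  φ≢ψ : ∀ {u j} (s : Star j) → u ≢ 0 → φ u ≢ ψ j s
  φ≢ψ {u} s u≢0 e with piece u | s
  ... | cycle _ φu   | inj₁ _        = u≢0 (trans (sym φu) e)
  ... | cycle u<k φu | inj₂ (inj₁ _) = <⇒≢ u<k (trans (sym φu) e)
  ... | cycle u<k φu | inj₂ (inj₂ _) = <⇒≢ (<-trans u<k (n<1+n k)) (trans (sym φu) e)
  ... | tail _ φu    | inj₁ _        = 1+n≢0 (trans (sym φu) e)
  ... | tail k≤u φu  | inj₂ (inj₁ _) = <⇒≢ (tail-above k≤u) (sym (trans (sym φu) e))
  ... | tail k≤u φu  | inj₂ (inj₂ _) = <⇒≢ (s≤s (s≤s k≤u)) (sym (trans (sym φu) e))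

  incident⇒star : ∀ {j} → Incident (lollipop k ℓ) 0 j → Star j
  incident⇒star {j} 0∈j with lolEnds k j | lollipopEdge k j
  ... | _ | cycle-edge _    = [ inj₁ ∘ sym , (λ ()) ]′ 0∈j
  ... | _ | closing-edge sj≡k = inj₂ (inj₁ (suc-injective sj≡k))
  ... | _ | stem-edge j≡k   = inj₂ (inj₂ j≡k)
  ... | _ | tail-edge k<j   = ⊥-elim ([ (λ 0≡j∸1 → <⇒≱ (s≤s z≤n) (subst (k ≤_) (sym 0≡j∸1) (∸-monoˡ-≤ 1 k<j)))
                                      , (λ 0≡j → <⇒≱ k<j (subst (_≤ k) 0≡j z≤n)) ]′ 0∈j)

  Step : ℕ → ℕ → Set
  Step a b = suc a ≡ b × b ≢ suc k

  _~_ : ℕ → ℕ → Set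
  a ~ b = Step a b ⊎ Step b a

  ~⇒adj : ∀ {g g′ : Fin (suc k + suc ℓ)} → toℕ g ~ toℕ g′ → Adj (P (suc k) ∪G P (suc ℓ)) g g′
  ~⇒adj (inj₁ (step , ≢)) = proj₁ (P∪P-adj (suc k) (suc ℓ) step ≢)
  ~⇒adj (inj₂ (step , ≢)) = proj₂ (P∪P-adj (suc k) (suc ℓ) step ≢)

  edge~ : ∀ j → proj₁ (lolEnds k j) ≢ 0 → proj₂ (lolEnds k j) ≢ 0 →
          φ (proj₁ (lolEnds k j)) ~ φ (proj₂ (lolEnds k j))
  edge~ j with lolEnds k j | lollipopEdge k j
  ... | _ | cycle-edge sj<k = λ _ _ → subst₂ _~_ (sym (φ-cycle (<-trans (n<1+n j) sj<k))) (sym (φ-cycle sj<k))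
                                        (inj₁ (refl , <⇒≢ (<-trans sj<k (n<1+n k))))
  ... | _ | closing-edge _  = λ _ 0≢0 → ⊥-elim (0≢0 refl)
  ... | _ | stem-edge _     = λ 0≢0 _ → ⊥-elim (0≢0 refl)
  ... | _ | tail-edge k<j   = λ _ _ → tail~ k<j
    where
    tail~ : ∀ {j} → k < j → φ (j ∸ 1) ~ φ j
    tail~ {suc j} k<sj = subst₂ _~_ (sym (φ-tail (s≤s⁻¹ k<sj))) (sym (φ-tail (<⇒≤ k<sj)))
                           (inj₁ (refl , ≢-sym (<⇒≢ (s≤s (tail-above (s≤s⁻¹ k<sj))))))

  star~ : ∀ {u j} (s : Star j) → Incident (lollipop k ℓ) u j → u ≢ 0 → φ u ~ ψ j s
  star~ {u} (inj₁ refl) u∈j u≢0 with lolEnds k 0 | lollipopEdge k 0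
  ... | _ | cycle-edge _     = [ ⊥-elim ∘ u≢0
                               , (λ { refl → subst (_~ 0) (sym (φ-cycle (s≤s 0<k₀))) (inj₂ (refl , λ ())) }) ]′ u∈j
  ... | _ | closing-edge 1≡k = ⊥-elim (<⇒≢ 0<k₀ (suc-injective 1≡k))
  star~ {u} (inj₂ (inj₁ refl)) u∈j u≢0 with lolEnds k k₀ | lollipopEdge k k₀
  ... | _ | cycle-edge k<k   = ⊥-elim (<-irrefl refl k<k)
  ... | _ | closing-edge _   = [ (λ { refl → subst (_~ k) (sym (φ-cycle (n<1+n k₀))) (inj₁ (refl , <⇒≢ (n<1+n k))) })
                               , ⊥-elim ∘ u≢0 ]′ u∈j
  ... | _ | stem-edge k₀≡k   = ⊥-elim (<⇒≢ (n<1+n k₀) k₀≡k)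
  ... | _ | tail-edge k<k₀   = ⊥-elim (<-asym k<k₀ (n<1+n k₀))
  star~ {u} (inj₂ (inj₂ refl)) u∈j u≢0 with lolEnds k k | lollipopEdge k k
  ... | _ | cycle-edge sk<k  = ⊥-elim (<-asym sk<k (n<1+n k))
  ... | _ | closing-edge sk≡k = ⊥-elim (<⇒≢ (n<1+n k) (sym sk≡k))
  ... | _ | stem-edge _      =
    [ ⊥-elim ∘ u≢0
    , (λ { refl → subst (_~ suc k) (sym (φ-tail ≤-refl)) (inj₂ (refl , ≢-sym (<⇒≢ (n<1+n (suc k))))) }) ]′ u∈j
  ... | _ | tail-edge k<k    = ⊥-elim (<-irrefl refl k<k)

  placement : StarPlacement (lollipop k ℓ) (P (suc k) ∪G P (suc ℓ))
  placement = record
    { centre = 0 ; Star = Star ; star? = λ j → (j ≟ 0) ⊎-dec (j ≟ k₀) ⊎-dec (j ≟ k)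
    ; incident⇒star = incident⇒star ; φ = φ ; ψ = ψ ; φ< = φ< ; ψ< = ψ<
    ; φ-injective = φ-injective ; ψ-injective = ψ-injective ; φ≢ψ = φ≢ψ
    ; _~_ = _~_ ; ~-sym = swap ; ~⇒adj = ~⇒adj ; edge~ = edge~ ; star~ = star~ }

lemma2p2 : (k ℓ p : ℕ) → 3 ≤ k → 2 ≤ p →
    ((i : ℕ) → 1 ≤ i → i < k →
      blowup p (lollipop k ℓ) ⊆ (Y k ℓ i ∨G Kmulti (p ∸ 1) (n (blowup p (lollipop k ℓ)))))
    × (blowup p (lollipop k ℓ) ⊆ ((P (suc k) ∪G P (suc ℓ)) ∨G Kmulti (p ∸ 1) (n (blowup p (lollipop k ℓ)))))
lemma2p2 k@(suc k₀) ℓ p@(suc (suc r)) (s≤s 2≤k₀) (s≤s (s≤s z≤n)) = attached , disjoint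
  where
  EmbedsInto : ℕ → Graph → Set
  EmbedsInto k G = blowup p (lollipop k ℓ) ⊆ (G ∨G Kmulti (suc r) (BV p (lollipop k ℓ)))

  attached : ∀ i → 1 ≤ i → i < k → EmbedsInto k (Y k ℓ i)
  attached i 0<i i<k = subst (λ k → EmbedsInto k (Y k ℓ i)) k≡c+i
    (blowup-⊆-∨G-Kmulti (AttachedPath.placement (k ∸ suc i) i ℓ 0<i) r)
    where
    k≡c+i : suc (k ∸ suc i) + i ≡ k
    k≡c+i = trans (cong (_+ i) (sym (+-∸-assoc 1 i<k))) (m∸n+n≡m (<⇒≤ i<k))

  disjoint : EmbedsInto k (P (suc k) ∪G P (suc ℓ))
  disjoint = blowup-⊆-∨G-Kmulti (DisjointPaths.placement k₀ ℓ (≤-trans (s≤s z≤n) 2≤k₀)) r
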